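{- Let $(G,f,\pi)$ be a monotone SDS and $1\le k\le n$. If $X\in[S_{0,k}]_\pi\cup[S_{1,k}]_\pi$ and $F_\pi(X)$ is not comparable to $X$, then $X$ is a Garden-of-Eden state. If $X\in[S_{0,k}]_\pi$ and $X>F_\pi(X)$, then $X$ is a Garden-of-Eden state. If $X\in[S_{1,k}]_\pi$ and $X<F_\pi(X)$, then $X$ is a Garden-of-Eden state.
   Context: Let $G$ be a simple graph with vertex set $\{1,\dots,n\}$, each vertex having a state in $\mathbb{F}_2=\{0,1\}$; states are $X=[x_1,\dots,x_n]\in\mathbb{F}_2^n$. Each vertex $i$ has a local function $f_i$ of the states of $i$ and its neighbours; its inflation $F_i:\mathbb{F}_2^n\to\mathbb{F}_2^n$ replaces coordinate $i$ by this value and fixes other coordinates. For an update schedule (permutation) $\pi=\pi_1\cdots\pi_n$, $F_\pi=F_{\pi_n}\circ\cdots\circ F_{\pi_1}$; $(G,f,\pi)$ is an SDS. Order $\mathbb{F}_2^n$ componentwise with $0<1$; the SDS is monotone if each $f_i$ is monotone. $X$ is a Garden-of-Eden state if no $Y$ satisfies $F_\pi(Y)=X$. Two schedules satisfy $\pi\sim_\alpha\pi'$ if $\pi'$ arises from $\pi$ by exchanging the entries in two consecutive positions $k,k+1$ whose vertices $\pi_k,\pi_{k+1}$ are not adjacent in $G$; $[\pi]_\alpha$ is the class of $\pi$ under the reflexive–transitive closure of $\sim_\alpha$. A schedule $\sigma=\sigma_1\cdots\sigma_n$ is regarded as the permutation $i\mapsto\sigma_i$ and acts by $\sigma\cdot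 X=[x_{\sigma^{ -1}(1)},\dots,x_{\sigma^{ -1}(n)}]$; $[X]_\pi=\{\sigma\cdot X:\sigma\in[\pi]_\alpha\}$. $S_{0,k}$ has $x_i=0$ for $i\le k$ and $x_i=1$ otherwise; $S_{1,k}$ has $x_i=1$ for $i\le k$ and $x_i=0$ otherwise. -}

module Defs where

open import Data.Nat using (ℕ; zero; suc; _<_; _≤_)
import Data.Nat
open import Data.Fin using (Fin; toℕ; _≟_)
open import Data.Fin.Permutation using (Permutation′; _⟨$⟩ʳ_)
open import Data.Bool using (Bool; true; false; if_then_else_)
import Data.Bool as B
open import Data.List using (List; foldl; map)
open import Data.List using () renaming (allFin to allFinL)
open import Data.Product using (Σ; ∃; _×_; _,_)
open import Data.Sum using (_⊎_)
open import Relation.Nullary using (¬_; yes; no)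
open import Relation.Binary.PropositionalEquality using (_≡_)
open import Relation.Binary.Construct.Closure.ReflexiveTransitive using (Star)

-- A simple graph on vertex set Fin n (vertex i ↔ paper's vertex toℕ i + 1).
record SimpleGraph (n : ℕ) : Set₁ where
  field
    Adj    : Fin n → Fin n → Set
    sym    : ∀ {i j} → Adj i j → Adj j i
    irrefl : ∀ {i} → ¬ Adj i i
open SimpleGraph public

-- States X ∈ F₂ⁿ, with false = 0, true = 1.
State : ℕ → Set
State n = Fin n → Bool

IsLocal : ∀ {n} → SimpleGraph n → (Fin n → State n → Bool) → Set
IsLocal {n} G f = ∀ (i : Fin n) (X Y : State n) → X i ≡ Y i →
  (∀ j → Adj G i j → X j ≡ Y j) → f i X ≡ f i Y

_≤ₛ_ : ∀ {n} → State n → State n → Set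
X ≤ₛ Y = ∀ i → X i B.≤ Y i

_<ₛ_ : ∀ {n} → State n → State n → Set
X <ₛ Y = X ≤ₛ Y × ¬ (∀ i → X i ≡ Y i)

Comparable : ∀ {n} → State n → State n → Set
Comparable X Y = X ≤ₛ Y ⊎ Y ≤ₛ X

IsMonotone : ∀ {n} → (Fin n → State n → Bool) → Set
IsMonotone {n} f = ∀ (i : Fin n) (X Y : State n) → X ≤ₛ Y → f i X B.≤ f i Y

inflate : ∀ {n} → (Fin n → State n → Bool) → Fin n → State n → State n
inflate f i X j with j ≟ i
... | yes _ = f i X
... | no  _ = X j

-- F_π = F_{π_n} ∘ ⋯ ∘ F_{π_1}; position p (0-based) holds vertex π p
SDSmap : ∀ {n} → (Fin n → State n → Bool) → (Fin n → Fin n) → State n → State n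
SDSmap {n} f π X = foldl (λ Y i → inflate f i Y) X (map π (allFinL n))

data AlphaStep {n} (G : SimpleGraph n) (σ σ' : Fin n → Fin n) : Set where
  swap : (k k' : Fin n) → toℕ k' ≡ suc (toℕ k) → ¬ Adj G (σ k) (σ k') →
         σ' k ≡ σ k' → σ' k' ≡ σ k →
         (∀ p → ¬ p ≡ k → ¬ p ≡ k' → σ' p ≡ σ p) → AlphaStep G σ σ'

InAlphaClass : ∀ {n} → SimpleGraph n → (Fin n → Fin n) → (Fin n → Fin n) → Set
InAlphaClass G π σ = Star (AlphaStep G) π σ

-- σ · X = [x_{σ⁻¹(1)}, …], i.e. (σ · X)(σ i) = X i
-- Y ∈ [X]_π
InOrbit : ∀ {n} → SimpleGraph n → (Fin n → Fin n) → State n → State n → Set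
InOrbit {n} G π X Y = Σ (Fin n → Fin n) λ σ → InAlphaClass G π σ × (∀ i → Y (σ i) ≡ X i)

S0 : ∀ {n} → ℕ → State n
S0 k i with suc (toℕ i) Data.Nat.≤? k
... | yes _ = false
... | no  _ = true

S1 : ∀ {n} → ℕ → State n
S1 k i with suc (toℕ i) Data.Nat.≤? k
... | yes _ = true
... | no  _ = false

GardenOfEden : ∀ {n} → (State n → State n) → State n → Set
GardenOfEden {n} F X = ¬ (Σ (State n) λ Y → ∀ i → F Y i ≡ X i)

LocalFuns : ℕ → Set
LocalFuns n = Fin n → State n → Bool

-- If F_π(Y) = X and X ∈ [S_{0,k}]_π, pick σ ∈ [π]_α with σ · S_{0,k} = X; then F_π = F_σ, and σ
-- first updates a block A of vertices where X is 0 and then a block B where X is 1. After A, the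
-- run from Y is already below the run from X: on vertices with X = 1 the run from X still shows 1
-- (they lie outside A), and on vertices with X = 0 the run from Y already shows its final value 0
-- (they lie outside B). Monotonicity through B gives X = F_π(Y) ≤ F_π(X), which excludes both
-- F_π(X) < X and incomparability. The case S_{1,k} is dual.
module Submission where

open import Defs hiding (sym)
open import Data.Nat using (ℕ; zero; suc; _≤_; _<_; s≤s; z≤n)
import Data.Nat as ℕ
open import Data.Nat.Properties using (suc-injective)
open import Data.Fin using (Fin; zero; suc; toℕ; _≟_)
import Data.Fin.Properties as Fin
open import Data.Fin.Permutation using (Permutation′; _⟨$⟩ʳ_)
open import Data.Bool using (true; false)
import Data.Bool as B
open import Data.Bool.Properties using (≤-antisym; ≤-minimum; ≤-maximum; ≤-poset; not-¬)
open import Data.List using (List; []; _∷_; foldl; map; take; drop; _++_; tabulate)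
open import Data.List.Properties using (foldl-++; map-tabulate; tabulate-cong; take++drop≡id)
open import Data.List.Membership.Propositional using (_∉_)
open import Data.List.Relation.Unary.Any using (here; there)
open import Data.List.Relation.Unary.All as All using (All; []; _∷_)
open import Data.List.Relation.Unary.All.Properties using (tabulate⁺)
open import Data.Product using (_×_; _,_)
open import Data.Sum using (_⊎_; inj₁; inj₂)
open import Function using (id; _∘_)
open import Relation.Nullary using (¬_; Dec; yes; no; contradiction)
open import Relation.Binary.PropositionalEquality
open import Relation.Binary.Construct.Closure.ReflexiveTransitive using (ε; _◅_)
import Relation.Binary.Reasoning.PartialOrder as PosetReasoning

All-take-tabulate : ∀ {a p} {A : Set a} {P : A → Set p} {m} {h : Fin m → A} k →
  (∀ i → toℕ i < k → P (h i)) → All P (take k (tabulate h))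
All-take-tabulate             zero    Ph = []
All-take-tabulate {m = zero}  (suc k) Ph = []
All-take-tabulate {m = suc m} (suc k) Ph =
  Ph zero (s≤s z≤n) ∷ All-take-tabulate k (λ i i<k → Ph (suc i) (s≤s i<k))

All-drop-tabulate : ∀ {a p} {A : Set a} {P : A → Set p} {m} {h : Fin m → A} k →
  (∀ i → ¬ toℕ i < k → P (h i)) → All P (drop k (tabulate h))
All-drop-tabulate             zero    Ph = tabulate⁺ (λ i → Ph i (λ ()))
All-drop-tabulate {m = zero}  (suc k) Ph = []
All-drop-tabulate {m = suc m} (suc k) Ph =
  All-drop-tabulate k (λ i i≮k → Ph (suc i) (λ { (s≤s i<k) → i≮k i<k }))

module _ {n : ℕ} {k : ℕ} {i : Fin n} where

  S0-< : toℕ i < k → S0 k i ≡ false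
  S0-< i<k with suc (toℕ i) ℕ.≤? k
  ... | yes _   = refl
  ... | no  i≮k = contradiction i<k i≮k

  S0-≮ : ¬ toℕ i < k → S0 k i ≡ true
  S0-≮ i≮k with suc (toℕ i) ℕ.≤? k
  ... | yes i<k = contradiction i<k i≮k
  ... | no  _   = refl

  S1-< : toℕ i < k → S1 k i ≡ true
  S1-< i<k with suc (toℕ i) ℕ.≤? k
  ... | yes _   = refl
  ... | no  i≮k = contradiction i<k i≮k

  S1-≮ : ¬ toℕ i < k → S1 k i ≡ false
  S1-≮ i≮k with suc (toℕ i) ℕ.≤? k
  ... | yes i<k = contradiction i<k i≮k
  ... | no  _   = refl

module _ {n : ℕ} (f : LocalFuns n) where

  run : List (Fin n) → State n → State n
  run vs X = foldl (λ Y v → inflate f v Y) X vs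

  inflate-self : ∀ v X → inflate f v X v ≡ f v X
  inflate-self v X with v ≟ v
  ... | yes _   = refl
  ... | no  v≢v = contradiction refl v≢v

  inflate-other : ∀ v X {i} → i ≢ v → inflate f v X i ≡ X i
  inflate-other v X {i} i≢v with i ≟ v
  ... | yes i≡v = contradiction i≡v i≢v
  ... | no  _   = refl

  run-outside : ∀ vs X {i} → i ∉ vs → run vs X i ≡ X i
  run-outside []       X i∉vs = refl
  run-outside (v ∷ vs) X i∉vs =
    trans (run-outside vs (inflate f v X) (i∉vs ∘ there)) (inflate-other v X (i∉vs ∘ here))

  run-++ : ∀ us vs X → run (us ++ vs) X ≡ run vs (run us X)
  run-++ us vs X = foldl-++ (λ Y v → inflate f v Y) X us vs

  run-prefix-of-preimage : ∀ us vs {X Y i} → run (us ++ vs) Y ≗ X → i ∉ vs → run us Y i ≡ X i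
  run-prefix-of-preimage us vs {X} {Y} {i} runY≗X i∉vs = begin
    run us Y i            ≡⟨ run-outside vs (run us Y) i∉vs ⟨
    run vs (run us Y) i   ≡⟨ cong (λ Z → Z i) (run-++ us vs Y) ⟨
    run (us ++ vs) Y i    ≡⟨ runY≗X i ⟩
    X i                   ∎
    where open ≡-Reasoning

  ∉-by-value : ∀ {X : State n} {b} vs {i} → All (λ v → X v ≡ b) vs → X i ≡ B.not b → i ∉ vs
  ∉-by-value vs Xvs≡b Xi≡¬b i∈vs = not-¬ (All.lookup Xvs≡b i∈vs) Xi≡¬b

  module _ (G : SimpleGraph n) (loc : IsLocal G f) where

    inflate-cong : ∀ v {X Y} → X ≗ Y → inflate f v X ≗ inflate f v Y
    inflate-cong v {X} {Y} X≗Y i with i ≟ v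
    ... | yes refl = loc i X Y (X≗Y i) (λ j _ → X≗Y j)
    ... | no  _    = X≗Y i

    run-cong : ∀ vs {X Y} → X ≗ Y → run vs X ≗ run vs Y
    run-cong []       X≗Y = X≗Y
    run-cong (v ∷ vs) X≗Y = run-cong vs (inflate-cong v X≗Y)

    f-inflate-nonadjacent : ∀ {u v} X → u ≢ v → ¬ Adj G u v → f u (inflate f v X) ≡ f u X
    f-inflate-nonadjacent {u} {v} X u≢v ¬uv =
      loc u _ X (inflate-other v X u≢v)
        (λ w uw → inflate-other v X (λ { refl → ¬uv uw }))

    inflate-comm : ∀ {u v} → ¬ Adj G u v → ∀ X →
      inflate f v (inflate f u X) ≗ inflate f u (inflate f v X)
    inflate-comm {u} {v} ¬uv X i = by-cases (i ≟ u) (i ≟ v)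
      where
      open ≡-Reasoning
      by-cases : Dec (i ≡ u) → Dec (i ≡ v) → inflate f v (inflate f u X) i ≡ inflate f u (inflate f v X) i
      by-cases (yes refl) (yes refl) = refl
      by-cases (yes refl) (no i≢v)   = begin
        inflate f v (inflate f i X) i ≡⟨ inflate-other v _ i≢v ⟩
        inflate f i X i               ≡⟨ inflate-self i X ⟩
        f i X                         ≡⟨ f-inflate-nonadjacent X i≢v ¬uv ⟨
        f i (inflate f v X)           ≡⟨ inflate-self i _ ⟨
        inflate f i (inflate f v X) i ∎
      by-cases (no i≢u)   (yes refl) = begin
        inflate f i (inflate f u X) i ≡⟨ inflate-self i _ ⟩
        f i (inflate f u X)           ≡⟨ f-inflate-nonadjacent X i≢u (¬uv ∘ SimpleGraph.sym G) ⟩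
        f i X                         ≡⟨ inflate-self i X ⟨
        inflate f i X i               ≡⟨ inflate-other u _ i≢u ⟨
        inflate f u (inflate f i X) i ∎
      by-cases (no i≢u)   (no i≢v)   = begin
        inflate f v (inflate f u X) i ≡⟨ inflate-other v _ i≢v ⟩
        inflate f u X i               ≡⟨ inflate-other u X i≢u ⟩
        X i                           ≡⟨ inflate-other v X i≢v ⟨
        inflate f v X i               ≡⟨ inflate-other u _ i≢u ⟨
        inflate f u (inflate f v X) i ∎

    run-tabulate-swap : ∀ {m} (h h′ : Fin m → Fin n) (p p′ : Fin m) → toℕ p′ ≡ suc (toℕ p) →
      ¬ Adj G (h p) (h p′) → h′ p ≡ h p′ → h′ p′ ≡ h p →
      (∀ q → q ≢ p → q ≢ p′ → h′ q ≡ h q) →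
      ∀ X → run (tabulate h) X ≗ run (tabulate h′) X
    run-tabulate-swap {suc (suc m)} h h′ zero (suc zero) _ ¬adj h′₀ h′₁ rest X i =
      trans (run-cong (tabulate (λ q → h (suc (suc q)))) (inflate-comm ¬adj X) i)
            (cong₂ (λ vs Y → run vs Y i)
              (tabulate-cong (λ q → sym (rest (suc (suc q)) (λ ()) (λ ()))))
              (cong₂ (λ u v → inflate f v (inflate f u X)) (sym h′₀) (sym h′₁)))
    run-tabulate-swap {suc m} h h′ (suc p) (suc p′) p′≡1+p ¬adj h′p h′p′ rest X i =
      trans (run-tabulate-swap (h ∘ suc) (h′ ∘ suc) p p′ (suc-injective p′≡1+p) ¬adj h′p h′p′
               (λ q q≢p q≢p′ → rest (suc q) (q≢p ∘ Fin.suc-injective) (q≢p′ ∘ Fin.suc-injective))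
               (inflate f (h zero) X) i)
            (cong (λ v → run (tabulate (h′ ∘ suc)) (inflate f v X) i) (sym (rest zero (λ ()) (λ ()))))
    run-tabulate-swap _ _ zero    zero          () _ _ _ _ _
    run-tabulate-swap _ _ zero    (suc (suc _)) () _ _ _ _ _
    run-tabulate-swap _ _ (suc _) zero          () _ _ _ _ _

    run-alpha : ∀ {σ σ′} → InAlphaClass G σ σ′ → ∀ X → run (tabulate σ) X ≗ run (tabulate σ′) X
    run-alpha ε                                           X i = refl
    run-alpha (swap p p′ p′≡1+p ¬adj σ′p σ′p′ rest ◅ σ′~σ″) X i =
      trans (run-tabulate-swap _ _ p p′ p′≡1+p ¬adj σ′p σ′p′ rest X i) (run-alpha σ′~σ″ X i)

    SDSmap-split : ∀ {π σ} → InAlphaClass G π σ → ∀ k X →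
      SDSmap f π X ≗ run (take k (tabulate σ) ++ drop k (tabulate σ)) X
    SDSmap-split {π} {σ} π~σ k X i = begin
      run (map π (tabulate id)) X i                         ≡⟨ cong (λ vs → run vs X i) (map-tabulate id π) ⟩
      run (tabulate π) X i                                  ≡⟨ run-alpha π~σ X i ⟩
      run (tabulate σ) X i                                  ≡⟨ cong (λ vs → run vs X i) (take++drop≡id k (tabulate σ)) ⟨
      run (take k (tabulate σ) ++ drop k (tabulate σ)) X i ∎
      where open ≡-Reasoning

  module _ (mono : IsMonotone f) where

    inflate-mono : ∀ v {X Y} → X ≤ₛ Y → inflate f v X ≤ₛ inflate f v Y
    inflate-mono v {X} {Y} X≤Y i with i ≟ v
    ... | yes refl = mono i X Y X≤Y
    ... | no  _    = X≤Y i

    run-mono : ∀ vs {X Y} → X ≤ₛ Y → run vs X ≤ₛ run vs Y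
    run-mono []       X≤Y = X≤Y
    run-mono (v ∷ vs) X≤Y = run-mono vs (inflate-mono v X≤Y)

    run-++-mono : ∀ us vs {X Y} → run us X ≤ₛ run us Y → run (us ++ vs) X ≤ₛ run (us ++ vs) Y
    run-++-mono us vs {X} {Y} usX≤usY i = begin
      run (us ++ vs) X i  ≡⟨ cong (λ Z → Z i) (run-++ us vs X) ⟩
      run vs (run us X) i ≤⟨ run-mono vs usX≤usY i ⟩
      run vs (run us Y) i ≡⟨ cong (λ Z → Z i) (run-++ us vs Y) ⟨
      run (us ++ vs) Y i  ∎
      where open PosetReasoning ≤-poset

    ≤-run-of-preimage : ∀ us vs {X Y} → All (λ v → X v ≡ false) us → All (λ v → X v ≡ true) vs →
      run (us ++ vs) Y ≗ X → X ≤ₛ run (us ++ vs) X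
    ≤-run-of-preimage us vs {X} {Y} Xus≡0 Xvs≡1 runY≗X i =
      subst (B._≤ run (us ++ vs) X i) (runY≗X i) (run-++-mono us vs prefix-≤ i)
      where
      prefix-≤ : run us Y ≤ₛ run us X
      prefix-≤ j with X j in Xj
      ... | true  = subst (run us Y j B.≤_)
                      (trans (sym Xj) (sym (run-outside us X (∉-by-value us Xus≡0 Xj))))
                      (≤-maximum _)
      ... | false = subst (B._≤ run us X j)
                      (trans (sym Xj) (sym (run-prefix-of-preimage us vs runY≗X (∉-by-value vs Xvs≡1 Xj))))
                      (≤-minimum _)

    run-≤-of-preimage : ∀ us vs {X Y} → All (λ v → X v ≡ true) us → All (λ v → X v ≡ false) vs →
      run (us ++ vs) Y ≗ X → run (us ++ vs) X ≤ₛ X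
    run-≤-of-preimage us vs {X} {Y} Xus≡1 Xvs≡0 runY≗X i =
      subst (run (us ++ vs) X i B.≤_) (runY≗X i) (run-++-mono us vs prefix-≤ i)
      where
      prefix-≤ : run us X ≤ₛ run us Y
      prefix-≤ j with X j in Xj
      ... | false = subst (B._≤ run us Y j)
                      (trans (sym Xj) (sym (run-outside us X (∉-by-value us Xus≡1 Xj))))
                      (≤-minimum _)
      ... | true  = subst (run us X j B.≤_)
                      (trans (sym Xj) (sym (run-prefix-of-preimage us vs runY≗X (∉-by-value vs Xvs≡0 Xj))))
                      (≤-maximum _)

  module _ (G : SimpleGraph n) (loc : IsLocal G f) (mono : IsMonotone f) {π : Fin n → Fin n} {k : ℕ} where

    ≤-image-of-S0-orbit : ∀ {X Y} → InOrbit G π (S0 k) X → SDSmap f π Y ≗ X → X ≤ₛ SDSmap f π X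
    ≤-image-of-S0-orbit {X} {Y} (σ , π~σ , Xσ≗S0) FY≗X i =
      subst (X i B.≤_) (sym (split X i))
        (≤-run-of-preimage mono (take k (tabulate σ)) (drop k (tabulate σ))
          (All-take-tabulate k (λ p p<k → trans (Xσ≗S0 p) (S0-< p<k)))
          (All-drop-tabulate k (λ p p≮k → trans (Xσ≗S0 p) (S0-≮ p≮k)))
          (λ j → trans (sym (split Y j)) (FY≗X j)) i)
      where
      split : ∀ Z → SDSmap f π Z ≗ run (take k (tabulate σ) ++ drop k (tabulate σ)) Z
      split = SDSmap-split G loc π~σ k

    image-≤-of-S1-orbit : ∀ {X Y} → InOrbit G π (S1 k) X → SDSmap f π Y ≗ X → SDSmap f π X ≤ₛ X
    image-≤-of-S1-orbit {X} {Y} (σ , π~σ , Xσ≗S1) FY≗X i =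
      subst (B._≤ X i) (sym (split X i))
        (run-≤-of-preimage mono (take k (tabulate σ)) (drop k (tabulate σ))
          (All-take-tabulate k (λ p p<k → trans (Xσ≗S1 p) (S1-< p<k)))
          (All-drop-tabulate k (λ p p≮k → trans (Xσ≗S1 p) (S1-≮ p≮k)))
          (λ j → trans (sym (split Y j)) (FY≗X j)) i)
      where
      split : ∀ Z → SDSmap f π Z ≗ run (take k (tabulate σ) ++ drop k (tabulate σ)) Z
      split = SDSmap-split G loc π~σ k

corollary3p10 : ∀ {n : ℕ} (G : SimpleGraph n) (f : LocalFuns n) (π : Permutation′ n) →
    IsLocal G f → IsMonotone f → (k : ℕ) → 1 ≤ k → k ≤ n → (X : State n) →
    ((InOrbit G (π ⟨$⟩ʳ_) (S0 k) X ⊎ InOrbit G (π ⟨$⟩ʳ_) (S1 k) X) →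
        ¬ Comparable (SDSmap f (π ⟨$⟩ʳ_) X) X → GardenOfEden (SDSmap f (π ⟨$⟩ʳ_)) X)
    × (InOrbit G (π ⟨$⟩ʳ_) (S0 k) X → SDSmap f (π ⟨$⟩ʳ_) X <ₛ X → GardenOfEden (SDSmap f (π ⟨$⟩ʳ_)) X)
    × (InOrbit G (π ⟨$⟩ʳ_) (S1 k) X → X <ₛ SDSmap f (π ⟨$⟩ʳ_) X → GardenOfEden (SDSmap f (π ⟨$⟩ʳ_)) X)
corollary3p10 G f π loc mono k _ _ X =
    (λ { (inj₁ X∈[S0]) F≭ (Y , FY≗X) → F≭ (inj₂ (≤-image-of-S0-orbit f G loc mono X∈[S0] FY≗X))
       ; (inj₂ X∈[S1]) F≭ (Y , FY≗X) → F≭ (inj₁ (image-≤-of-S1-orbit f G loc mono X∈[S1] FY≗X)) })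
  , (λ X∈[S0] (FX≤X , FX≉X) (Y , FY≗X) →
       FX≉X (λ i → ≤-antisym (FX≤X i) (≤-image-of-S0-orbit f G loc mono X∈[S0] FY≗X i)))
  , (λ X∈[S1] (X≤FX , X≉FX) (Y , FY≗X) →
       X≉FX (λ i → ≤-antisym (X≤FX i) (image-≤-of-S1-orbit f G loc mono X∈[S1] FY≗X i)))
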